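{- Let $k,C\ge1$ be integers. There exists an alphabet $\Sigma\subset\mathbb{N}$ of size $k$ such that, for every $C$-balanced infinite word $\mathbf{w}$ over $\Sigma$, $\rho^{\mathrm{add}}_{\mathbf{w}}=\rho^{\mathrm{ab}}_{\mathbf{w}}$.
   Context: For a word $w$, $|w|_a$ counts occurrences of $a$. An infinite word $\mathbf{w}$ is $C$-balanced if $\big||u|_a-|v|_a\big|\le C$ for all letters $a$ and all factors $u,v$ of $\mathbf{w}$ with $|u|=|v|$. Words $u,v$ over $\Sigma\subset\mathbb{N}$ are abelian equivalent if $|u|_a=|v|_a$ for all $a\in\Sigma$, and additively equivalent if $|u|=|v|$ and $\sum_{a\in\Sigma}a|u|_a=\sum_{a\in\Sigma}a|v|_a$. $\rho^{\mathrm{ab}}_{\mathbf{w}}(n)$ (resp. $\rho^{\mathrm{add}}_{\mathbf{w}}(n)$) is the number of abelian (resp. additive) equivalence classes of length-$n$ factors of $\mathbf{w}$. -}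

module Defs where

open import Data.Nat using (ℕ; zero; suc; _+_; _*_; _≤_; ∣_-_∣)
open import Data.Nat.Properties using (_≟_)
open import Data.List using (List; []; _∷_; length; filter; map)
open import Data.Nat.ListAction using (sum)
open import Data.List.Membership.Propositional using (_∈_)
open import Data.Fin using (Fin)
open import Data.Product using (Σ; ∃; _×_)
open import Relation.Binary.PropositionalEquality using (_≡_)

Word : Set
Word = ℕ → ℕ

IsOver : List ℕ → Word → Set
IsOver Σ' w = ∀ i → w i ∈ Σ'

factor : Word → ℕ → ℕ → List ℕ
factor w i zero    = []
factor w i (suc n) = w i ∷ factor w (suc i) n

count : ℕ → List ℕ → ℕ
count a u = length (filter (a ≟_) u)

CBalanced : ℕ → List ℕ → Word → Set
CBalanced C Σ' w = ∀ a → a ∈ Σ' → ∀ i j n →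
  ∣ count a (factor w i n) - count a (factor w j n) ∣ ≤ C

AbEq : List ℕ → List ℕ → List ℕ → Set
AbEq Σ' u v = ∀ a → a ∈ Σ' → count a u ≡ count a v

weight : List ℕ → List ℕ → ℕ
weight Σ' u = sum (map (λ a → a * count a u) Σ')

AddEq : List ℕ → List ℕ → List ℕ → Set
AddEq Σ' u v = length u ≡ length v × weight Σ' u ≡ weight Σ' v

-- NumClasses R w n m : the length-n factors of w fall into exactly m
-- R-equivalence classes, witnessed by m starting positions whose factors
-- are pairwise R-inequivalent and represent every length-n factor.
-- (For an equivalence relation R this says ρ^R_w(n) = m.)
NumClasses : (List ℕ → List ℕ → Set) → Word → ℕ → ℕ → Set
NumClasses R w n m =
  Σ (Fin m → ℕ) λ p →
    (∀ x y → R (factor w (p x) n) (factor w (p y) n) → x ≡ y)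
    × (∀ i → ∃ λ x → R (factor w i n) (factor w (p x) n))

{-# OPTIONS --safe #-}
-- Take Σ = {1, B, B², …, B^(k-1)} with B = C + 1. The weight of a word is then the
-- base-B expansion Σᵢ Bⁱ |u|_{Bⁱ}; two factors of a C-balanced word of the same length
-- have letter counts differing by at most C < B, so, reading digits off from the
-- lowest, equal weights force equal counts. Hence additive equivalence coincides with
-- abelian equivalence on the factors, and so do the numbers of classes.
module Submission where

open import Defs
open import Data.Nat using (ℕ; zero; suc; _+_; _*_; _≤_; _<_; ∣_-_∣; s≤s)
open import Data.Nat.Properties
open import Data.List using (List; []; _∷_; length; map)
open import Data.List.Properties using (length-map)
open import Data.List.Membership.Propositional using (_∈_)
open import Data.List.Membership.Propositional.Properties using (∈-map⁺; ∈-map⁻)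
open import Data.List.Relation.Unary.Any using (here; there)
open import Data.List.Relation.Unary.All using (tabulate)
open import Data.List.Relation.Unary.AllPairs using ([]; _∷_)
open import Data.List.Relation.Unary.Unique.Propositional using (Unique)
open import Data.List.Relation.Unary.Unique.Propositional.Properties using (map⁺)
open import Data.Nat.ListAction using (sum)
open import Data.Product using (Σ; _×_; _,_; proj₁; proj₂)
open import Data.Empty using (⊥)
open import Function using (_∘_; _∘₂_)
open import Function.Bundles using (_⇔_; mk⇔; Equivalence)
open import Function.Properties.Equivalence using () renaming (sym to ⇔-sym)
open import Relation.Binary.PropositionalEquality
  using (_≡_; refl; sym; trans; cong; cong₂; subst₂; module ≡-Reasoning)

open ≡-Reasoning

digits-unique : ∀ B {x y X Y} → ∣ x - y ∣ < B → x + B * X ≡ y + B * Y → x ≡ y × X ≡ Y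
digits-unique B {x} {y} {X} {Y} close eq = x≡y , X≡Y
  where
  ∣x-y∣≡B*∣Y-X∣ : ∣ x - y ∣ ≡ B * ∣ Y - X ∣
  ∣x-y∣≡B*∣Y-X∣ = begin
    ∣ x - y ∣                         ≡⟨ ∣m+n-m+o∣≡∣n-o∣ (B * X) x y ⟨
    ∣ B * X + x - B * X + y ∣         ≡⟨ cong ∣_- B * X + y ∣ (trans (+-comm (B * X) x) eq) ⟩
    ∣ y + B * Y - B * X + y ∣         ≡⟨ cong ∣ y + B * Y -_∣ (+-comm (B * X) y) ⟩
    ∣ y + B * Y - y + B * X ∣         ≡⟨ ∣m+n-m+o∣≡∣n-o∣ y (B * Y) (B * X) ⟩
    ∣ B * Y - B * X ∣                 ≡⟨ *-distribˡ-∣-∣ B Y X ⟨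
    B * ∣ Y - X ∣                     ∎

  X≡Y : X ≡ Y
  X≡Y = sym (∣m-n∣≡0⇒m≡n (n<1⇒n≡0 (*-cancelˡ-< B _ 1
          (subst₂ _<_ ∣x-y∣≡B*∣Y-X∣ (sym (*-identityʳ B)) close))))

  x≡y : x ≡ y
  x≡y = +-cancelʳ-≡ (B * X) x y (trans eq (cong (λ Z → y + B * Z) (sym X≡Y)))

weightedSum : List ℕ → (ℕ → ℕ) → ℕ
weightedSum L f = sum (map (λ a → a * f a) L)

weightedSum-cong : ∀ L {f g} → (∀ {a} → a ∈ L → f a ≡ g a) → weightedSum L f ≡ weightedSum L g
weightedSum-cong []      f≡g = refl
weightedSum-cong (a ∷ L) f≡g =
  cong₂ _+_ (cong (a *_) (f≡g (here refl))) (weightedSum-cong L (f≡g ∘ there))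

weightedSum-map-* : ∀ B L f → weightedSum (map (B *_) L) f ≡ B * weightedSum L (f ∘ (B *_))
weightedSum-map-* B []      f = sym (*-zeroʳ B)
weightedSum-map-* B (a ∷ L) f = begin
  B * a * f (B * a) + weightedSum (map (B *_) L) f       ≡⟨ cong₂ _+_ (*-assoc B a _) (weightedSum-map-* B L f) ⟩
  B * (a * f (B * a)) + B * weightedSum L (f ∘ (B *_))   ≡⟨ *-distribˡ-+ B _ _ ⟨
  B * weightedSum (a ∷ L) (f ∘ (B *_))                   ∎

powersOf : ℕ → ℕ → List ℕ
powersOf B zero    = []
powersOf B (suc k) = 1 ∷ map (B *_) (powersOf B k)

length-powersOf : ∀ B k → length (powersOf B k) ≡ k
length-powersOf B zero    = refl
length-powersOf B (suc k) = cong suc (trans (length-map (B *_) (powersOf B k)) (length-powersOf B k))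

powersOf-unique : ∀ b k → Unique (powersOf (2 + b) k)
powersOf-unique b zero    = []
powersOf-unique b (suc k) =
  tabulate 1∉B*L ∷ map⁺ (λ {m} {n} → *-cancelˡ-≡ m n B) (powersOf-unique b k)
  where
  B = 2 + b
  1∉B*L : ∀ {n} → n ∈ map (B *_) (powersOf B k) → 1 ≡ n → ⊥
  1∉B*L n∈ 1≡n with ∈-map⁻ (B *_) n∈
  ... | m , _ , refl with m*n≡1⇒m≡1 B m (sym 1≡n)
  ... | ()

weightedSum-powersOf-suc : ∀ B k f →
  weightedSum (powersOf B (suc k)) f ≡ f 1 + B * weightedSum (powersOf B k) (f ∘ (B *_))
weightedSum-powersOf-suc B k f =
  cong₂ _+_ (*-identityˡ (f 1)) (weightedSum-map-* B (powersOf B k) f)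

weightedSum-powersOf-suc-digits : ∀ B k {f g} → ∣ f 1 - g 1 ∣ < B →
  weightedSum (powersOf B (suc k)) f ≡ weightedSum (powersOf B (suc k)) g →
  f 1 ≡ g 1 × weightedSum (powersOf B k) (f ∘ (B *_)) ≡ weightedSum (powersOf B k) (g ∘ (B *_))
weightedSum-powersOf-suc-digits B k {f} {g} close eq = digits-unique B close (begin
  f 1 + B * weightedSum (powersOf B k) (f ∘ (B *_)) ≡⟨ weightedSum-powersOf-suc B k f ⟨
  weightedSum (powersOf B (suc k)) f                 ≡⟨ eq ⟩
  weightedSum (powersOf B (suc k)) g                 ≡⟨ weightedSum-powersOf-suc B k g ⟩
  g 1 + B * weightedSum (powersOf B k) (g ∘ (B *_)) ∎)

weightedSum-powersOf-injective : ∀ B k {f g} →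
  (∀ {a} → a ∈ powersOf B k → ∣ f a - g a ∣ < B) →
  weightedSum (powersOf B k) f ≡ weightedSum (powersOf B k) g →
  ∀ {a} → a ∈ powersOf B k → f a ≡ g a
weightedSum-powersOf-injective B (suc k) close eq (here refl) =
  proj₁ (weightedSum-powersOf-suc-digits B k (close (here refl)) eq)
weightedSum-powersOf-injective B (suc k) close eq (there a∈B*L) with ∈-map⁻ (B *_) a∈B*L
... | b , b∈ , refl =
  weightedSum-powersOf-injective B k (close ∘ there ∘ ∈-map⁺ (B *_))
    (proj₂ (weightedSum-powersOf-suc-digits B k (close (here refl)) eq)) b∈

length-factor : ∀ w i n → length (factor w i n) ≡ n
length-factor w i zero    = refl
length-factor w i (suc n) = cong suc (length-factor w (suc i) n)

NumClasses-transport : ∀ (R R' : List ℕ → List ℕ → Set) w n m →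
  (∀ i j → R (factor w i n) (factor w j n) ⇔ R' (factor w i n) (factor w j n)) →
  NumClasses R w n m → NumClasses R' w n m
NumClasses-transport R R' w n m R⇔R' (p , distinct , cover) =
    p
  , (λ x y r → distinct x y (Equivalence.from (R⇔R' (p x) (p y)) r))
  , (λ i → proj₁ (cover i) , Equivalence.to (R⇔R' i (p (proj₁ (cover i)))) (proj₂ (cover i)))

NumClasses-cong : ∀ (R R' : List ℕ → List ℕ → Set) w n m →
  (∀ i j → R (factor w i n) (factor w j n) ⇔ R' (factor w i n) (factor w j n)) →
  NumClasses R w n m ⇔ NumClasses R' w n m
NumClasses-cong R R' w n m R⇔R' =
  mk⇔ (NumClasses-transport R R' w n m R⇔R') (NumClasses-transport R' R w n m (⇔-sym ∘₂ R⇔R'))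

AbEq⇒AddEq : ∀ Σ' u v → length u ≡ length v → AbEq Σ' u v → AddEq Σ' u v
AbEq⇒AddEq Σ' u v |u|≡|v| ab = |u|≡|v| , weightedSum-cong Σ' (λ {a} → ab a)

AddEq⇒AbEq-powersOf : ∀ B k u v → (∀ a → a ∈ powersOf B k → ∣ count a u - count a v ∣ < B) →
  AddEq (powersOf B k) u v → AbEq (powersOf B k) u v
AddEq⇒AbEq-powersOf B k u v close (_ , weight≡) a =
  weightedSum-powersOf-injective B k (λ {a} → close a) weight≡

balanced-factors-AddEq⇔AbEq : ∀ C k w → CBalanced C (powersOf (suc C) k) w →
  ∀ n i j → AddEq (powersOf (suc C) k) (factor w i n) (factor w j n)
          ⇔ AbEq (powersOf (suc C) k) (factor w i n) (factor w j n)
balanced-factors-AddEq⇔AbEq C k w balanced n i j = mk⇔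
  (AddEq⇒AbEq-powersOf (suc C) k u v (λ a a∈ → s≤s (balanced a a∈ i j n)))
  (AbEq⇒AddEq (powersOf (suc C) k) u v (trans (length-factor w i n) (sym (length-factor w j n))))
  where
  u = factor w i n
  v = factor w j n

theorem5p2 : (k C : ℕ) → 1 ≤ k → 1 ≤ C →
    Σ (List ℕ) λ Σ' → Unique Σ' × length Σ' ≡ k ×
    ((w : Word) → IsOver Σ' w → CBalanced C Σ' w →
    ∀ n m → NumClasses (AddEq Σ') w n m ⇔ NumClasses (AbEq Σ') w n m)
theorem5p2 k C@(suc C') _ _ =
    Σ'
  , powersOf-unique C' k
  , length-powersOf (suc C) k
  , λ w _ balanced n m →
      NumClasses-cong (AddEq Σ') (AbEq Σ') w n m (balanced-factors-AddEq⇔AbEq C k w balanced n)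
  where
  Σ' = powersOf (suc C) k
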